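{- Every prime number which is antipalindromic in base $3$ has an expansion in base $3$ with an odd number $n$ of digits, where $n\ge3$.
   Context: For $b\in\mathbb N$, $b\ge2$, write a natural number $m$ in base $b$ as $m=a_nb^n+\dots+a_1b+a_0$ with digits $a_i\in\{0,1,\dots,b-1\}$ and $a_n\neq 0$. The number $m$ is called antipalindromic in base $b$ if $a_j=b-1-a_{n-j}$ for all $j\in\{0,1,\dots,n\}$. -}

module Defs where

open import Data.Nat using (ℕ; zero; suc; _+_; _∸_; _≤_; _<_; NonZero)
open import Data.Nat.DivMod using (_/_; _%_; m/n<m)
open import Data.Nat.Induction using (<-wellFounded)
open import Data.List using (List; []; _∷_; length; lookup)
open import Data.Fin using (Fin; opposite)
open import Induction.WellFounded using (Acc; acc)
open import Relation.Binary.PropositionalEquality using (_≡_)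

-- Base-b digits of m, least significant first: [a₀, a₁, …, aₙ] with aₙ ≠ 0.
-- digits b 0 = [] (zero has no digits with a nonzero leading digit).
digitsAcc : (b : ℕ) → .{{_ : NonZero b}} → 2 ≤ b → (m : ℕ) → Acc _<_ m → List ℕ
digitsAcc b 2≤b zero    _         = []
digitsAcc b 2≤b (suc k) (acc rec) =
  (suc k % b) ∷ digitsAcc b 2≤b (suc k / b) (rec (m/n<m (suc k) b 2≤b))

digits : (b : ℕ) → .{{_ : NonZero b}} → 2 ≤ b → ℕ → List ℕ
digits b 2≤b m = digitsAcc b 2≤b m (<-wellFounded m)

Antipalindromic : (b : ℕ) → .{{_ : NonZero b}} → 2 ≤ b → ℕ → Set
Antipalindromic b 2≤b m =
  let ds = digits b 2≤b m in
  (j : Fin (length ds)) →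
    lookup ds j ≡ (b ∸ 1) ∸ lookup ds (opposite j)

{-# OPTIONS --safe #-}
-- In an antipalindrome each base-3 digit and its mirror image add up to 2, so the
-- digit sum equals the number n of digits. Since 3 ≡ 1 (mod 2), a number is congruent
-- to its digit sum modulo 2, hence p ≡ n (mod 2). An even n would make p = 2, whose
-- expansion (2) is not antipalindromic; n = 1 would force p < 3.
module Submission where

open import Defs
open import Algebra.Properties.CommutativeMonoid.Sum as Sum using ()
open import Data.Empty using (⊥-elim)
open import Data.Fin using (Fin; zero; suc; opposite)
import Data.Fin.Permutation as Perm
open import Data.List using (length; lookup)
open import Data.Nat using (ℕ; zero; suc; _+_; _*_; _∸_; _≤_; _<_; s≤s; z≤n; NonZero)
open import Data.Nat.Base using (nonTrivial⇒n>1)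
open import Data.Nat.DivMod using (_/_; _%_; m/n<m; m≡m%n+[m/n]*n; m%n<n; m/n≡0⇒m<n)
open import Data.Nat.Divisibility using (_∣_; m∣m*n; ∣m∣n⇒∣m+n)
open import Data.Nat.Induction using (<-wellFounded)
open import Data.Nat.Primality using (Prime; prime⇒irreducible; prime⇒nonTrivial)
open import Data.Nat.Properties
open import Data.Nat.Tactic.RingSolver using (solve-∀)
open import Data.Product using (Σ; ∃-syntax; _×_; _,_)
open import Data.Sum using (_⊎_; inj₁; inj₂)
open import Function using (_∘_)
open import Induction.WellFounded using (acc)
open import Relation.Binary.PropositionalEquality
open import Relation.Nullary using (¬_)

open Sum +-0-commutativeMonoid using (sum; sum-cong-≗; ∑-distrib-+; ∑-permute)

∑-const : ∀ n c → sum {n} (λ _ → c) ≡ n * c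
∑-const zero    c = refl
∑-const (suc n) c = cong (c +_) (∑-const n c)

even⊎odd : ∀ n → (∃[ k ] n ≡ 2 * k) ⊎ (∃[ k ] n ≡ 2 * k + 1)
even⊎odd zero = inj₁ (0 , refl)
even⊎odd (suc n) with even⊎odd n
... | inj₁ (k , refl) = inj₂ (k , +-comm 1 (2 * k))
... | inj₂ (k , refl) = inj₁ (suc k , cong suc (trans (+-comm (2 * k) 1) (sym (+-suc k (k + 0)))))

module _ (b : ℕ) .{{_ : NonZero b}} (2≤b : 2 ≤ b) where

  digitSum : ℕ → ℕ
  digitSum m = sum (lookup (digits b 2≤b m))

  digitsAcc-<base : ∀ m a j → lookup (digitsAcc b 2≤b m a) j < b
  digitsAcc-<base (suc k) (acc _) zero    = m%n<n (suc k) b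
  digitsAcc-<base (suc k) (acc _) (suc j) = digitsAcc-<base (suc k / b) _ j

  length-digitsAcc≡0⇒≡0 : ∀ m a → length (digitsAcc b 2≤b m a) ≡ 0 → m ≡ 0
  length-digitsAcc≡0⇒≡0 zero    _       _  = refl
  length-digitsAcc≡0⇒≡0 (suc k) (acc _) ()

  length-digitsAcc≡1⇒<base : ∀ m a → length (digitsAcc b 2≤b m a) ≡ 1 → m < b
  length-digitsAcc≡1⇒<base (suc k) (acc _) eq =
    m/n≡0⇒m<n (length-digitsAcc≡0⇒≡0 (suc k / b) _ (suc-injective eq))

  -- Since b = 1 + (b ∸ 1), the number r + q b differs from r + q by a multiple of b ∸ 1.
  digitsAcc-congruence : ∀ m a → ∃[ t ] m ≡ sum (lookup (digitsAcc b 2≤b m a)) + (b ∸ 1) * t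
  digitsAcc-congruence zero    _       = 0 , sym (*-zeroʳ (b ∸ 1))
  digitsAcc-congruence (suc k) (acc rec)
    with digitsAcc-congruence (suc k / b) (rec (m/n<m (suc k) b 2≤b))
  ... | t , q≡s+ct = t + q , (begin
      suc k                              ≡⟨ m≡m%n+[m/n]*n (suc k) b ⟩
      r + q * b                          ≡⟨ cong (λ x → r + q * x) b≡1+c ⟩
      r + q * suc c                      ≡⟨ cong (λ x → r + x * suc c) q≡s+ct ⟩
      r + (s + c * t) * suc c            ≡⟨ regroup r s c t ⟩
      (r + s) + c * (t + (s + c * t))    ≡⟨ cong (λ x → (r + s) + c * (t + x)) q≡s+ct ⟨
      (r + s) + c * (t + q)              ∎)
    where
    open ≡-Reasoning
    r q c s : ℕ
    r = suc k % b
    q = suc k / b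
    c = b ∸ 1
    s = sum (lookup (digitsAcc b 2≤b q (rec (m/n<m (suc k) b 2≤b))))
    b≡1+c : b ≡ suc c
    b≡1+c = sym (m+[n∸m]≡n (≤-trans (s≤s z≤n) 2≤b))
    regroup : ∀ r s c t → r + (s + c * t) * suc c ≡ (r + s) + c * (t + (s + c * t))
    regroup = solve-∀

  digitSum-congruence : ∀ m → ∃[ t ] m ≡ digitSum m + (b ∸ 1) * t
  digitSum-congruence m = digitsAcc-congruence m (<-wellFounded m)

  antipalindromic⇒digit+mirror≡b∸1 : ∀ m → Antipalindromic b 2≤b m →
    ∀ j → lookup (digits b 2≤b m) j + lookup (digits b 2≤b m) (opposite j) ≡ b ∸ 1
  antipalindromic⇒digit+mirror≡b∸1 m anti j = begin
    d j + d (opposite j)            ≡⟨ cong (_+ d (opposite j)) (anti j) ⟩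
    (b ∸ 1) ∸ d (opposite j) + d (opposite j)
      ≡⟨ m∸n+n≡m (<⇒≤pred (digitsAcc-<base m (<-wellFounded m) (opposite j))) ⟩
    b ∸ 1                           ∎
    where
    open ≡-Reasoning
    d : Fin (length (digits b 2≤b m)) → ℕ
    d = lookup (digits b 2≤b m)

  antipalindromic⇒2*digitSum≡length*[b∸1] : ∀ m → Antipalindromic b 2≤b m →
    2 * digitSum m ≡ length (digits b 2≤b m) * (b ∸ 1)
  antipalindromic⇒2*digitSum≡length*[b∸1] m anti = begin
    2 * sum d                            ≡⟨ cong (sum d +_) (+-identityʳ (sum d)) ⟩
    sum d + sum d                        ≡⟨ cong (sum d +_) (∑-permute d Perm.reverse) ⟩
    sum d + sum (d ∘ opposite)           ≡⟨ ∑-distrib-+ d (d ∘ opposite) ⟨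
    sum (λ j → d j + d (opposite j))     ≡⟨ sum-cong-≗ (antipalindromic⇒digit+mirror≡b∸1 m anti) ⟩
    sum {L} (λ _ → b ∸ 1)                ≡⟨ ∑-const L (b ∸ 1) ⟩
    L * (b ∸ 1)                          ∎
    where
    open ≡-Reasoning
    d : Fin (length (digits b 2≤b m)) → ℕ
    d = lookup (digits b 2≤b m)
    L : ℕ
    L = length (digits b 2≤b m)

2≤3 : 2 ≤ 3
2≤3 = s≤s (s≤s z≤n)

antipalindromic₃⇒length-congruence : ∀ {m} → Antipalindromic 3 2≤3 m →
  ∃[ t ] m ≡ length (digits 3 2≤3 m) + 2 * t
antipalindromic₃⇒length-congruence {m} anti with digitSum-congruence 3 2≤3 m
... | t , m≡S+2t = t , trans m≡S+2t (cong (_+ 2 * t) S≡L)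
  where
  S≡L : digitSum 3 2≤3 m ≡ length (digits 3 2≤3 m)
  S≡L = *-cancelˡ-≡ _ _ 2 (trans (antipalindromic⇒2*digitSum≡length*[b∸1] 3 2≤3 m anti)
                                 (*-comm (length (digits 3 2≤3 m)) 2))

¬antipalindromic₃-2 : ¬ Antipalindromic 3 2≤3 2
¬antipalindromic₃-2 anti with anti zero
... | ()

prime-antipalindromic₃⇒3≤p : ∀ {p} → Prime p → Antipalindromic 3 2≤3 p → 3 ≤ p
prime-antipalindromic₃⇒3≤p {p} p-prime anti =
  ≤∧≢⇒< (nonTrivial⇒n>1 p {{prime⇒nonTrivial p-prime}}) 2≢p
  where
  2≢p : 2 ≢ p
  2≢p refl = ¬antipalindromic₃-2 anti

prime-even⇒≡2 : ∀ {p} → Prime p → 2 ∣ p → p ≡ 2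
prime-even⇒≡2 p-prime 2∣p with prime⇒irreducible p-prime 2∣p
... | inj₂ 2≡p = sym 2≡p

mainTheorem7 : (p : ℕ) → Prime p → Antipalindromic 3 (s≤s (s≤s z≤n)) p →
    Σ ℕ (λ k → length (digits 3 (s≤s (s≤s z≤n)) p) ≡ 2 * k + 1)
    × 3 ≤ length (digits 3 (s≤s (s≤s z≤n)) p)
mainTheorem7 p p-prime anti
  with even⊎odd (length (digits 3 2≤3 p)) | antipalindromic₃⇒length-congruence anti
... | inj₁ (k , L≡2k) | t , p≡L+2t = ⊥-elim (<⇒≢ 3≤p (sym (prime-even⇒≡2 p-prime 2∣p)))
  where
  3≤p : 3 ≤ p
  3≤p = prime-antipalindromic₃⇒3≤p p-prime anti
  2∣p : 2 ∣ p
  2∣p = subst (2 ∣_) (sym (trans p≡L+2t (cong (_+ 2 * t) L≡2k)))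
              (∣m∣n⇒∣m+n (m∣m*n k) (m∣m*n t))
... | inj₂ (zero , L≡1) | _ =
  ⊥-elim (<⇒≱ (length-digitsAcc≡1⇒<base 3 2≤3 p (<-wellFounded p) L≡1)
              (prime-antipalindromic₃⇒3≤p p-prime anti))
... | inj₂ (suc k , L≡2[k+1]+1) | _ =
  (suc k , L≡2[k+1]+1) ,
  subst (3 ≤_) (sym L≡2[k+1]+1) (+-monoˡ-≤ 1 (*-monoʳ-≤ 2 (s≤s (z≤n {k}))))
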